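{- Let $\mathcal{S}$ be an interval structure, $\varphi$ a $\mathsf{BE}_\pi$ formula, and $\mathcal{I}$ an intersecting family of non-singleton intervals that are prefix-minimal (resp. suffix-minimal) for $\varphi$, with pairwise distinct right (resp. left) endpoints. Let $\mathcal{I}'\subseteq\mathcal{I}$ be a chain or an anti-chain of $\mathcal{I}$ with respect to the partial order of set containment. Then $|\mathcal{I}'|\le 2^{2|\varphi|}$.
   Context: Time domain: a finite initial segment $N=\{0,\dots,n\}$ of the natural numbers; intervals $[x,y]=\{z:x\le z\le y\}$ with $x\le y$ in $N$, set $\mathbb{I}(N)$; an interval is a singleton if $x=y$. $J$ is a proper prefix of $I$ if $\min(I)=\min(J)\le\max(J)<\max(I)$; a proper suffix if $\min(I)<\min(J)\le\max(J)=\max(I)$. An interval structure over a finite nonempty signature $\Sigma$ is $\mathcal{S}=(N,\sigma)$ with $\sigma:\mathbb{I}(N)\to 2^\Sigma$. $\mathsf{BE}$ formulas: $\varphi ::= p \mid \neg\varphi \mid \varphi\vee\varphi \mid \langle B\rangle\varphi \mid \langle E\rangle\varphi$ with $\mathcal{S},I\models p$ iff $p\in\sigma(I)$ and $\langle B\rangle\varphi$ (resp. $\langle E\rangle\varphi$) true at $I$ iff $\varphi$ holds at some proper prefix (resp. proper suffix) of $I$. Abbreviations: $\mathit{false}=p\wedge\neg p$, $[X]\varphi=\neg\langle X\rangle\neg\varphi$, $\pi=[B]\mathit{false}$. $\mathsf{BE}_\pi$ is the set of formulas in which every occurrence of a letter $p$ appears inside a subformula $\pi\wedge p$ (such subformulas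 treated as atomic); $|\varphi|$ denotes the size of $\varphi$. An interval $I$ is prefix-minimal (resp. suffix-minimal) for $\varphi$ if $\mathcal{S},I\models\varphi$ and $\mathcal{S},J\not\models\varphi$ for every proper prefix (resp. proper suffix) $J$ of $I$. A set of intervals is an intersecting family if some point belongs to all its intervals. A chain is a set of pairwise comparable elements, an anti-chain a set of pairwise incomparable elements. -}

module Defs where

open import Data.Nat using (ℕ; suc; _+_; _≤_)
open import Data.Fin using (Fin) renaming (zero to fzero)
open import Data.Fin.Subset using (Subset; _∈_)
open import Data.Product using (Σ; ∃; _×_; _,_)
open import Data.Sum using (_⊎_)
open import Data.List using (List)
import Data.List.Membership.Propositional as LM
open import Relation.Nullary using (¬_)
open import Relation.Binary.PropositionalEquality using (_≡_; _≢_)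

record Interval (n : ℕ) : Set where
  constructor [_,_]⟨_,_⟩
  field
    lo   : ℕ
    hi   : ℕ
    lo≤hi : lo ≤ hi
    hi≤n  : hi ≤ n
open Interval public

_∈ᵢ_ : {n : ℕ} → ℕ → Interval n → Set
z ∈ᵢ I = lo I ≤ z × z ≤ hi I

Singleton : {n : ℕ} → Interval n → Set
Singleton I = lo I ≡ hi I

ProperPrefix : {n : ℕ} → Interval n → Interval n → Set
ProperPrefix J I = lo I ≡ lo J × suc (hi J) ≤ hi I

ProperSuffix : {n : ℕ} → Interval n → Interval n → Set
ProperSuffix J I = suc (lo I) ≤ lo J × hi J ≡ hi I

_⊆ᵢ_ : {n : ℕ} → Interval n → Interval n → Set
I ⊆ᵢ J = ∀ z → z ∈ᵢ I → z ∈ᵢ J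

record Structure (n k : ℕ) : Set where
  constructor structure
  field
    σ : Interval n → Subset (suc k)
open Structure public

data Form (k : ℕ) : Set where
  atom : Fin (suc k) → Form k
  ¬f   : Form k → Form k
  _∨f_ : Form k → Form k → Form k
  ⟨B⟩  : Form k → Form k
  ⟨E⟩  : Form k → Form k

_⊨_∶_ : {n k : ℕ} → Structure n k → Interval n → Form k → Set
S ⊨ I ∶ atom p   = p ∈ σ S I
S ⊨ I ∶ ¬f φ     = ¬ (S ⊨ I ∶ φ)
S ⊨ I ∶ (φ ∨f ψ) = (S ⊨ I ∶ φ) ⊎ (S ⊨ I ∶ ψ)
S ⊨ I ∶ ⟨B⟩ φ    = ∃ λ J → ProperPrefix J I × (S ⊨ J ∶ φ)
S ⊨ I ∶ ⟨E⟩ φ    = ∃ λ J → ProperSuffix J I × (S ⊨ J ∶ φ)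

_∧f_ : {k : ℕ} → Form k → Form k → Form k
φ ∧f ψ = ¬f (¬f φ ∨f ¬f ψ)

falsef : {k : ℕ} → Form k
falsef = atom fzero ∧f ¬f (atom fzero)

[B] : {k : ℕ} → Form k → Form k
[B] φ = ¬f (⟨B⟩ (¬f φ))

πf : {k : ℕ} → Form k
πf = [B] falsef

-- BE_π formulas: every letter occurs inside a subformula π ∧ p, which is
-- treated as atomic.

data BEπ (k : ℕ) : Set where
  πp   : Fin (suc k) → BEπ k
  ¬π   : BEπ k → BEπ k
  _∨π_ : BEπ k → BEπ k → BEπ k
  ⟨B⟩π : BEπ k → BEπ k
  ⟨E⟩π : BEπ k → BEπ k

toForm : {k : ℕ} → BEπ k → Form k
toForm (πp p)   = πf ∧f atom p
toForm (¬π φ)   = ¬f (toForm φ)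
toForm (φ ∨π ψ) = toForm φ ∨f toForm ψ
toForm (⟨B⟩π φ) = ⟨B⟩ (toForm φ)
toForm (⟨E⟩π φ) = ⟨E⟩ (toForm φ)

size : {k : ℕ} → BEπ k → ℕ
size (πp p)   = 1
size (¬π φ)   = suc (size φ)
size (φ ∨π ψ) = suc (size φ + size ψ)
size (⟨B⟩π φ) = suc (size φ)
size (⟨E⟩π φ) = suc (size φ)

PrefixMinimal : {n k : ℕ} → Structure n k → BEπ k → Interval n → Set
PrefixMinimal S φ I =
  (S ⊨ I ∶ toForm φ) × (∀ J → ProperPrefix J I → ¬ (S ⊨ J ∶ toForm φ))

SuffixMinimal : {n k : ℕ} → Structure n k → BEπ k → Interval n → Set
SuffixMinimal S φ I =
  (S ⊨ I ∶ toForm φ) × (∀ J → ProperSuffix J I → ¬ (S ⊨ J ∶ toForm φ))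

-- Finite families of intervals (given as lists; cardinality = length
-- of a duplicate-free list)

module _ {n : ℕ} where
  open LM {A = Interval n} using () renaming (_∈_ to _∈L_)

  Intersecting : List (Interval n) → Set
  Intersecting 𝓘 = ∃ λ z → ∀ I → I ∈L 𝓘 → z ∈ᵢ I

  DistinctRight : List (Interval n) → Set
  DistinctRight 𝓘 = ∀ I J → I ∈L 𝓘 → J ∈L 𝓘 → hi I ≡ hi J → I ≡ J

  DistinctLeft : List (Interval n) → Set
  DistinctLeft 𝓘 = ∀ I J → I ∈L 𝓘 → J ∈L 𝓘 → lo I ≡ lo J → I ≡ J

  SubFamily : List (Interval n) → List (Interval n) → Set
  SubFamily 𝓘' 𝓘 = ∀ I → I ∈L 𝓘' → I ∈L 𝓘

  Chain : List (Interval n) → Set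
  Chain 𝓘 = ∀ I J → I ∈L 𝓘 → J ∈L 𝓘 → I ⊆ᵢ J ⊎ J ⊆ᵢ I

  AntiChain : List (Interval n) → Set
  AntiChain 𝓘 = ∀ I J → I ∈L 𝓘 → J ∈L 𝓘 → I ≢ J → ¬ (I ⊆ᵢ J)

-- Fix a point z lying in every interval.  To a left endpoint x ≤ z attach a profile, a number
-- below 2 ^ |φ|, such that equal profiles make φ agree on [x, y] and [x′, y] for every y ≥ z:
-- ⟨B⟩ψ adds one bit (is there a witness in [x, z)?) to the profile of ψ, and ⟨E⟩ψ records how
-- many ψ-profiles are realised in (x, z], which determines that set because these sets shrink
-- as x grows.  If two prefix-minimal intervals through z had equal left profiles but different
-- right endpoints, the longer one would have a proper prefix satisfying φ; so on a family with
-- distinct right endpoints the profile is injective.  Suffix-minimal families are the mirror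
-- image under t ↦ n ∸ t.  Hence such a family has at most 2 ^ |φ| ≤ 2 ^ (2|φ|) members.

module Submission where

open import Defs
open import Data.Bool using (Bool; true; false; _∨_; _∧_; not; T)
open import Data.Bool.Properties using (T-∨; T-∧; T-≡)
open import Data.Empty using (⊥-elim)
open import Data.Fin using (Fin; combine; cast; fromℕ<; toℕ)
  renaming (zero to fzero; suc to fsuc)
import Data.Fin.Properties as Fin
open import Data.Fin.Subset using (Subset; ∣_∣; _⊆_) renaming (_∈_ to _∈ₛ_)
open import Data.Fin.Subset.Properties using (∣p∣≤n; ⊆-antisym; p⊂q⇒∣p∣<∣q∣; _∈?_)
open import Data.List using (List; length; lookup; _∷_)
open import Data.List.Membership.Propositional using (_∈_)
open import Data.List.Membership.Propositional.Properties using (∈-lookup)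
open import Data.List.Relation.Unary.AllPairs using (_∷_)
import Data.List.Relation.Unary.All as All
open import Data.List.Relation.Unary.Unique.Propositional using (Unique)
open import Data.Nat
  using (ℕ; zero; suc; _+_; _*_; _∸_; _^_; _≤_; _<_; z≤n; s≤s; s≤s⁻¹; _≤?_; _<?_; _≟_)
open import Data.Nat.Properties
open import Data.Product using (∃; _×_; _,_; proj₁; proj₂)
open import Data.Sum using (_⊎_; inj₁; inj₂)
import Data.Sum as Sum
open import Data.Vec using (tabulate)
open import Data.Vec.Properties using (lookup∘tabulate; []=⇒lookup; lookup⇒[]=)
open import Function using (_⇔_; mk⇔; Equivalence; _∘_)
open import Relation.Nullary using (¬_; Dec; yes; no; contradiction)
open import Relation.Nullary.Decidable using (⌊_⌋; toWitness; fromWitness; decidable-stable; map′)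
open import Relation.Binary.PropositionalEquality
  using (_≡_; refl; sym; trans; cong; cong₂; subst; module ≡-Reasoning)

open Equivalence using (to; from)

T-ext : ∀ {a b} → (T a → T b) → (T b → T a) → a ≡ b
T-ext {false} {false} _ _ = refl
T-ext {false} {true}  _ g = ⊥-elim (g _)
T-ext {true}  {false} f _ = ⊥-elim (f _)
T-ext {true}  {true}  _ _ = refl

T-not : ∀ {b} → T (not b) ⇔ (¬ T b)
T-not {false} = mk⇔ (λ _ ()) (λ _ → _)
T-not {true}  = mk⇔ (λ ()) (λ ¬t → ¬t _)

-- anyIn f a b: some c with a ≤ c < b satisfies f.
anyIn : (ℕ → Bool) → ℕ → ℕ → Bool
anyIn f a zero    = false
anyIn f a (suc b) = anyIn f a b ∨ (⌊ a ≤? b ⌋ ∧ f b)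

module _ {f : ℕ → Bool} where

  anyIn⁺ : ∀ {a b c} → a ≤ c → c < b → T (f c) → T (anyIn f a b)
  anyIn⁺ {a} {suc b} a≤c c<1+b fc with m<1+n⇒m<n∨m≡n c<1+b
  ... | inj₁ c<b  = from (T-∨ {anyIn f a b}) (inj₁ (anyIn⁺ a≤c c<b fc))
  ... | inj₂ refl =
    from (T-∨ {anyIn f a b}) (inj₂ (from T-∧ (fromWitness {a? = a ≤? b} a≤c , fc)))

  anyIn⁻ : ∀ {a b} → T (anyIn f a b) → ∃ λ c → a ≤ c × c < b × T (f c)
  anyIn⁻ {a} {suc b} t with to (T-∨ {anyIn f a b}) t
  ... | inj₁ t′ = let c , a≤c , c<b , fc = anyIn⁻ t′ in c , a≤c , m<n⇒m<1+n c<b , fc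
  ... | inj₂ t′ =
    let a≤b , fb = to (T-∧ {⌊ a ≤? b ⌋}) t′ in b , toWitness a≤b , n<1+n b , fb

  anyIn-split : ∀ {a b c} → a ≤ c → c ≤ b → anyIn f a b ≡ anyIn f a c ∨ anyIn f c b
  anyIn-split {a} {b} {c} a≤c c≤b = T-ext split join
    where
    split : T (anyIn f a b) → T (anyIn f a c ∨ anyIn f c b)
    split t with anyIn⁻ {a} {b} t
    ... | d , a≤d , d<b , fd with d <? c
    ...   | yes d<c = from (T-∨ {anyIn f a c}) (inj₁ (anyIn⁺ {b = c} a≤d d<c fd))
    ...   | no  d≮c = from (T-∨ {anyIn f a c}) (inj₂ (anyIn⁺ {b = b} (≮⇒≥ d≮c) d<b fd))
    join : T (anyIn f a c ∨ anyIn f c b) → T (anyIn f a b)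
    join t with to (T-∨ {anyIn f a c}) t
    ... | inj₁ t′ =
      let d , a≤d , d<c , fd = anyIn⁻ {a} {c} t′ in anyIn⁺ {b = b} a≤d (<-≤-trans d<c c≤b) fd
    ... | inj₂ t′ =
      let d , c≤d , d<b , fd = anyIn⁻ {c} {b} t′ in anyIn⁺ {b = b} (≤-trans a≤c c≤d) d<b fd

anyIn-cong : ∀ {f g a b} → (∀ c → a ≤ c → c < b → f c ≡ g c) → anyIn f a b ≡ anyIn g a b
anyIn-cong {b = zero}      _  = refl
anyIn-cong {a = a} {suc b} eq with a ≤? b
... | yes a≤b = cong₂ _∨_ below (eq b a≤b (n<1+n b))
  where below = anyIn-cong λ c a≤c c<b → eq c a≤c (m<n⇒m<1+n c<b)
... | no  _   = cong₂ _∨_ below refl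
  where below = anyIn-cong λ c a≤c c<b → eq c a≤c (m<n⇒m<1+n c<b)

-- Reflecting [a, b) through c ↦ m ∸ c gives (m ∸ b, m ∸ a].
anyIn-reflect : ∀ {f g a b m} → a ≤ b → b ≤ m → (∀ c → a ≤ c → c < b → f c ≡ g (m ∸ c)) →
                anyIn f a b ≡ anyIn g (suc (m ∸ b)) (suc (m ∸ a))
anyIn-reflect {f} {g} {a} {b} {m} a≤b b≤m eq = T-ext there back
  where
  there : T (anyIn f a b) → T (anyIn g (suc (m ∸ b)) (suc (m ∸ a)))
  there t with anyIn⁻ {a = a} {b = b} t
  ... | c , a≤c , c<b , fc =
    anyIn⁺ {b = suc (m ∸ a)} (∸-monoʳ-< c<b b≤m) (s≤s (∸-monoʳ-≤ m a≤c))
           (subst T (eq c a≤c c<b) fc)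
  back : T (anyIn g (suc (m ∸ b)) (suc (m ∸ a))) → T (anyIn f a b)
  back t with anyIn⁻ {a = suc (m ∸ b)} {b = suc (m ∸ a)} t
  ... | c , m∸b<c , c<1+m∸a , gc = anyIn⁺ {b = b} a≤m∸c m∸c<b fc
    where
    c≤m∸a = s≤s⁻¹ c<1+m∸a
    c≤m = ≤-trans c≤m∸a (m∸n≤m m a)
    a≤m∸c = m+n≤o⇒m≤o∸n a
              (subst (_≤ m) (+-comm c a) (m≤o∸n⇒m+n≤o c (≤-trans a≤b b≤m) c≤m∸a))
    m∸c<b = subst (m ∸ c <_) (m∸[m∸n]≡n b≤m) (∸-monoʳ-< m∸b<c c≤m)
    fc = subst T (sym (trans (eq (m ∸ c) a≤m∸c m∸c<b) (cong g (m∸[m∸n]≡n c≤m)))) gc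

image : ∀ {B} → (ℕ → Fin B) → ℕ → ℕ → Subset B
image f a b = tabulate λ v → anyIn (λ c → ⌊ f c Fin.≟ v ⌋) a b

module _ {B} {f : ℕ → Fin B} where

  ∈-image⇔ : ∀ {a b v} → v ∈ₛ image f a b ⇔ T (anyIn (λ c → ⌊ f c Fin.≟ v ⌋) a b)
  ∈-image⇔ {a} {b} {v} = mk⇔
    (λ v∈ → from T-≡ (trans (sym (lookup∘tabulate g v)) ([]=⇒lookup v∈)))
    (λ t → lookup⇒[]= v (image f a b) (trans (lookup∘tabulate g v) (to T-≡ t)))
    where
    g = λ v → anyIn (λ c → ⌊ f c Fin.≟ v ⌋) a b

  ∈-image⁺ : ∀ {a b c} → a ≤ c → c < b → f c ∈ₛ image f a b
  ∈-image⁺ {a} {b} a≤c c<b =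
    from (∈-image⇔ {a} {b}) (anyIn⁺ {b = b} a≤c c<b (fromWitness refl))

  ∈-image⁻ : ∀ {a b v} → v ∈ₛ image f a b → ∃ λ c → a ≤ c × c < b × f c ≡ v
  ∈-image⁻ {a} {b} v∈ =
    let c , a≤c , c<b , fc≡v = anyIn⁻ {a = a} {b = b} (to (∈-image⇔ {a} {b}) v∈)
    in c , a≤c , c<b , toWitness fc≡v

  image-antitoneˡ : ∀ {a a′ b} → a ≤ a′ → image f a′ b ⊆ image f a b
  image-antitoneˡ {a} {a′} {b} a≤a′ v∈ with ∈-image⁻ {a′} {b} v∈
  ... | c , a′≤c , c<b , refl = ∈-image⁺ {a} {b} (≤-trans a≤a′ a′≤c) c<b

⊆∧∣∣≡⇒⊇ : ∀ {B} {p q : Subset B} → p ⊆ q → ∣ p ∣ ≡ ∣ q ∣ → q ⊆ p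
⊆∧∣∣≡⇒⊇ {p = p} p⊆q ∣p∣≡∣q∣ {v} v∈q with v ∈? p
... | yes v∈p = v∈p
... | no  v∉p = contradiction ∣p∣≡∣q∣ (<⇒≢ (p⊂q⇒∣p∣<∣q∣ (p⊆q , v , v∈q , v∉p)))

-- The ranges [a, b) and [a′, b) are nested, hence so are the images; equal sizes make them equal.
∣image∣-injectiveˡ : ∀ {B} (f : ℕ → Fin B) {a a′ b} →
                     ∣ image f a b ∣ ≡ ∣ image f a′ b ∣ → image f a b ≡ image f a′ b
∣image∣-injectiveˡ f {a} {a′} {b} eq with ≤-total a a′
... | inj₁ a≤a′ = ⊆-antisym (⊆∧∣∣≡⇒⊇ sub (sym eq)) sub
  where sub = image-antitoneˡ {f = f} {b = b} a≤a′
... | inj₂ a′≤a = ⊆-antisym sub (⊆∧∣∣≡⇒⊇ sub eq)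
  where sub = image-antitoneˡ {f = f} {b = b} a′≤a

Labelling : ℕ → Set
Labelling k = ℕ → Fin (suc k) → Bool

-- Truth on [x, y]; π ∧ p holds only on singletons, so labelling the points suffices.
holds : ∀ {k} → Labelling k → BEπ k → ℕ → ℕ → Bool
holds L (πp p)   x y = ⌊ x ≟ y ⌋ ∧ L x p
holds L (¬π φ)   x y = not (holds L φ x y)
holds L (φ ∨π ψ) x y = holds L φ x y ∨ holds L ψ x y
holds L (⟨B⟩π φ) x y = anyIn (holds L φ x) x y
holds L (⟨E⟩π φ) x y = anyIn (λ c → holds L φ c y) (suc x) (suc y)

mirror : ∀ {k} → BEπ k → BEπ k
mirror (πp p)   = πp p
mirror (¬π φ)   = ¬π (mirror φ)
mirror (φ ∨π ψ) = mirror φ ∨π mirror ψ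
mirror (⟨B⟩π φ) = ⟨E⟩π (mirror φ)
mirror (⟨E⟩π φ) = ⟨B⟩π (mirror φ)

size-mirror : ∀ {k} (φ : BEπ k) → size (mirror φ) ≡ size φ
size-mirror (πp p)   = refl
size-mirror (¬π φ)   = cong suc (size-mirror φ)
size-mirror (φ ∨π ψ) = cong suc (cong₂ _+_ (size-mirror φ) (size-mirror ψ))
size-mirror (⟨B⟩π φ) = cong suc (size-mirror φ)
size-mirror (⟨E⟩π φ) = cong suc (size-mirror φ)

reflect : ∀ {k} → ℕ → Labelling k → Labelling k
reflect m L u = L (m ∸ u)

holds-mirror : ∀ {k} (L : Labelling k) φ {m x y} → x ≤ y → y ≤ m →
               holds L φ x y ≡ holds (reflect m L) (mirror φ) (m ∸ y) (m ∸ x)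
holds-mirror L (πp p) {m} {x} {y} x≤y y≤m with x ≟ y | m ∸ y ≟ m ∸ x
... | yes refl | yes _  = cong (λ u → L u p) (sym (m∸[m∸n]≡n y≤m))
... | yes refl | no ne  = contradiction refl ne
... | no ne    | yes eq = contradiction (sym (∸-cancelˡ-≡ y≤m (≤-trans x≤y y≤m) eq)) ne
... | no _     | no _   = refl
holds-mirror L (¬π φ) x≤y y≤m = cong not (holds-mirror L φ x≤y y≤m)
holds-mirror L (φ ∨π ψ) x≤y y≤m =
  cong₂ _∨_ (holds-mirror L φ x≤y y≤m) (holds-mirror L ψ x≤y y≤m)
holds-mirror L (⟨B⟩π φ) x≤y y≤m = anyIn-reflect x≤y y≤m λ c x≤c c<y →
  holds-mirror L φ x≤c (≤-trans (<⇒≤ c<y) y≤m)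
holds-mirror L (⟨E⟩π φ) {m} {x} {y} x≤y y≤m = begin
  anyIn (λ c → holds L φ c y) (suc x) (suc y)
    ≡⟨ cong₂ (λ a b → anyIn (λ c → holds L φ c y) (suc a) (suc b))
             (sym (m∸[m∸n]≡n (≤-trans x≤y y≤m))) (sym (m∸[m∸n]≡n y≤m)) ⟩
  anyIn (λ c → holds L φ c y) (suc (m ∸ (m ∸ x))) (suc (m ∸ (m ∸ y)))
    ≡⟨ sym (anyIn-reflect (∸-monoʳ-≤ m x≤y) (m∸n≤m m x) pointwise) ⟩
  anyIn (holds L′ φ′ (m ∸ y)) (m ∸ y) (m ∸ x) ∎
  where
  open ≡-Reasoning
  L′ = reflect m L
  φ′ = mirror φ
  pointwise : ∀ c → m ∸ y ≤ c → c < m ∸ x →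
              holds L′ φ′ (m ∸ y) c ≡ holds L φ (m ∸ c) y
  pointwise c m∸y≤c c<m∸x = sym (trans (holds-mirror L φ m∸c≤y y≤m)
                                       (cong (holds L′ φ′ (m ∸ y)) (m∸[m∸n]≡n c≤m)))
    where
    c≤m = ≤-trans (<⇒≤ c<m∸x) (m∸n≤m m x)
    m∸c≤y = subst (m ∸ c ≤_) (m∸[m∸n]≡n y≤m) (∸-monoʳ-≤ m m∸y≤c)

bit : Bool → Fin 2
bit false = fzero
bit true  = fsuc fzero

bit-injective : ∀ {a b} → bit a ≡ bit b → a ≡ b
bit-injective {false} {false} _ = refl
bit-injective {true}  {true}  _ = refl

tagged : ∀ s → Bool → Fin (2 ^ s) → Fin (2 ^ suc s)
tagged s b i = combine (bit b) i

tagged-injective : ∀ s {a b} {i j : Fin (2 ^ s)} →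
                   tagged s a i ≡ tagged s b j → a ≡ b × i ≡ j
tagged-injective s eq =
  let bits≡ , i≡j = Fin.combine-injective _ _ _ _ eq in bit-injective bits≡ , i≡j

pair : ∀ s t → Fin (2 ^ s) → Fin (2 ^ t) → Fin (2 ^ suc (s + t))
pair s t i j = tagged (s + t) false (cast (sym (^-distribˡ-+-* 2 s t)) (combine i j))

pair-injective : ∀ s t {i i′ : Fin (2 ^ s)} {j j′ : Fin (2 ^ t)} →
                 pair s t i j ≡ pair s t i′ j′ → i ≡ i′ × j ≡ j′
pair-injective s t {i} {i′} {j} {j′} eq =
  Fin.combine-injective i j i′ j′ (Fin.toℕ-injective (begin
    toℕ (combine i j)             ≡⟨ sym (Fin.toℕ-cast _ (combine i j)) ⟩
    toℕ (cast _ (combine i j))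
      ≡⟨ cong toℕ (proj₂ (tagged-injective (s + t) {false} {false} eq)) ⟩
    toℕ (cast _ (combine i′ j′))  ≡⟨ Fin.toℕ-cast _ (combine i′ j′) ⟩
    toℕ (combine i′ j′)           ∎))
  where open ≡-Reasoning

∣p∣<2^1+s : ∀ s (p : Subset (2 ^ s)) → ∣ p ∣ < 2 ^ suc s
∣p∣<2^1+s s p = ≤-<-trans (∣p∣≤n p) (^-monoʳ-< 2 (s≤s (s≤s z≤n)) (n<1+n s))

size-code : ∀ s → Subset (2 ^ s) → Fin (2 ^ suc s)
size-code s p = fromℕ< (∣p∣<2^1+s s p)

size-code-injective : ∀ s {p q : Subset (2 ^ s)} →
                      size-code s p ≡ size-code s q → ∣ p ∣ ≡ ∣ q ∣
size-code-injective s {p} {q} =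
  Fin.fromℕ<-injective ∣ p ∣ ∣ q ∣ (∣p∣<2^1+s s p) (∣p∣<2^1+s s q)

module Profile {k} (L : Labelling k) (z : ℕ) where

  profile : (φ : BEπ k) → ℕ → Fin (2 ^ size φ)
  profile (πp p)   x = bit ⌊ x ≟ z ⌋
  profile (¬π φ)   x = tagged (size φ) false (profile φ x)
  profile (φ ∨π ψ) x = pair (size φ) (size ψ) (profile φ x) (profile ψ x)
  profile (⟨B⟩π φ) x = tagged (size φ) (holds L (⟨B⟩π φ) x z) (profile φ x)
  profile (⟨E⟩π φ) x = size-code (size φ) (image (profile φ) (suc x) (suc z))

  point-off-pivot : ∀ p {x y} → x ≤ z → z ≤ y → ¬ x ≡ z → holds L (πp p) x y ≡ false
  point-off-pivot p {x} {y} x≤z z≤y x≢z with x ≟ y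
  ... | yes refl = contradiction (≤-antisym x≤z z≤y) x≢z
  ... | no  _    = refl

  profile-separates : ∀ φ {x x′ y} → x ≤ z → x′ ≤ z → z ≤ y →
                      profile φ x ≡ profile φ x′ → holds L φ x y ≡ holds L φ x′ y
  profile-separates (πp p) {x} {x′} x≤z x′≤z z≤y eq with x ≟ z | x′ ≟ z
  ... | yes refl | yes refl = refl
  ... | yes _    | no  _    = contradiction eq λ ()
  ... | no  _    | yes _    = contradiction eq λ ()
  ... | no  x≢z  | no  x′≢z =
    trans (point-off-pivot p x≤z z≤y x≢z) (sym (point-off-pivot p x′≤z z≤y x′≢z))
  profile-separates (¬π φ) x≤z x′≤z z≤y eq =
    cong not (profile-separates φ x≤z x′≤z z≤y
                (proj₂ (tagged-injective (size φ) {false} {false} eq)))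
  profile-separates (φ ∨π ψ) x≤z x′≤z z≤y eq =
    let eqφ , eqψ = pair-injective (size φ) (size ψ) eq
    in cong₂ _∨_ (profile-separates φ x≤z x′≤z z≤y eqφ)
                 (profile-separates ψ x≤z x′≤z z≤y eqψ)
  profile-separates (⟨B⟩π φ) {x} {x′} {y} x≤z x′≤z z≤y eq = begin
    anyIn (holds L φ x) x y
      ≡⟨ anyIn-split x≤z z≤y ⟩
    anyIn (holds L φ x) x z ∨ anyIn (holds L φ x) z y
      ≡⟨ cong₂ _∨_ eqB (anyIn-cong {b = y} λ c z≤c _ →
                          profile-separates φ x≤z x′≤z z≤c eqφ) ⟩
    anyIn (holds L φ x′) x′ z ∨ anyIn (holds L φ x′) z y
      ≡⟨ sym (anyIn-split x′≤z z≤y) ⟩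
    anyIn (holds L φ x′) x′ y ∎
    where
    open ≡-Reasoning
    parts = tagged-injective (size φ) {holds L (⟨B⟩π φ) x z} {holds L (⟨B⟩π φ) x′ z} eq
    eqB : anyIn (holds L φ x) x z ≡ anyIn (holds L φ x′) x′ z
    eqB = proj₁ parts
    eqφ : profile φ x ≡ profile φ x′
    eqφ = proj₂ parts
  profile-separates (⟨E⟩π φ) {x} {x′} {y} x≤z x′≤z z≤y eq =
    T-ext (transfer x≤z x′≤z realised≡) (transfer x′≤z x≤z (sym realised≡))
    where
    realised : ℕ → Subset (2 ^ size φ)
    realised u = image (profile φ) (suc u) (suc z)
    realised≡ : realised x ≡ realised x′
    realised≡ = ∣image∣-injectiveˡ (profile φ) {suc x} {suc x′} {suc z}
                  (size-code-injective (size φ) {realised x} {realised x′} eq)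
    -- A witness c ≤ u′ is traded for one in (u′, z] with the same profile.
    transfer : ∀ {u u′} → u ≤ z → u′ ≤ z → realised u ≡ realised u′ →
               T (holds L (⟨E⟩π φ) u y) → T (holds L (⟨E⟩π φ) u′ y)
    transfer {u} {u′} u≤z u′≤z same t with anyIn⁻ {a = suc u} {b = suc y} t
    ... | c , u<c , c≤y , ⊨c with u′ <? c
    ...   | yes u′<c = anyIn⁺ {b = suc y} u′<c c≤y ⊨c
    ...   | no  u′≮c
      with ∈-image⁻ {a = suc u′} {b = suc z}
             (subst (profile φ c ∈ₛ_) same (∈-image⁺ {a = suc u} {b = suc z} u<c (s≤s c≤z)))
      where c≤z = ≤-trans (≮⇒≥ u′≮c) u′≤z
    ...   | c′ , u′<c′ , c′<1+z , same-profile =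
      anyIn⁺ {b = suc y} u′<c′ (s≤s (≤-trans c′≤z z≤y))
             (subst T (sym (profile-separates φ c′≤z c≤z z≤y same-profile)) ⊨c)
      where
      c′≤z = s≤s⁻¹ c′<1+z
      c≤z = ≤-trans (≮⇒≥ u′≮c) u′≤z

open Profile using (profile; profile-separates)

rightProfile : ∀ {k} → Labelling k → (z m : ℕ) (φ : BEπ k) → ℕ → Fin (2 ^ size (mirror φ))
rightProfile L z m φ y = profile (reflect m L) (m ∸ z) (mirror φ) (m ∸ y)

rightProfile-separates : ∀ {k} (L : Labelling k) {z m} φ {x y y′} →
                         x ≤ z → z ≤ y → z ≤ y′ → y ≤ m → y′ ≤ m →
                         rightProfile L z m φ y ≡ rightProfile L z m φ y′ →
                         holds L φ x y ≡ holds L φ x y′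
rightProfile-separates L {z} {m} φ {x} {y} {y′} x≤z z≤y z≤y′ y≤m y′≤m eq = begin
  holds L φ x y
    ≡⟨ holds-mirror L φ (≤-trans x≤z z≤y) y≤m ⟩
  holds (reflect m L) (mirror φ) (m ∸ y) (m ∸ x)
    ≡⟨ profile-separates (reflect m L) (m ∸ z) (mirror φ)
         (∸-monoʳ-≤ m z≤y) (∸-monoʳ-≤ m z≤y′) (∸-monoʳ-≤ m x≤z) eq ⟩
  holds (reflect m L) (mirror φ) (m ∸ y′) (m ∸ x)
    ≡⟨ holds-mirror L φ (≤-trans x≤z z≤y′) y′≤m ⟨
  holds L φ x y′ ∎
  where open ≡-Reasoning

Interval-≡ : ∀ {n} {I J : Interval n} → lo I ≡ lo J → hi I ≡ hi J → I ≡ J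
Interval-≡ {I = [ x , y ]⟨ p , q ⟩} {[ .x , .y ]⟨ p′ , q′ ⟩} refl refl
  rewrite ≤-irrelevant p p′ | ≤-irrelevant q q′ = refl

module _ {n k} (S : Structure n k) where

  point : ∀ x → x ≤ n → Interval n
  point x x≤n = [ x , x ]⟨ ≤-refl , x≤n ⟩

  labelling : Labelling k
  labelling x p with x ≤? n
  ... | yes x≤n = ⌊ p ∈? σ S (point x x≤n) ⌋
  ... | no  _   = false

  ⊭false : ∀ I → ¬ (S ⊨ I ∶ falsef)
  ⊭false I h = h (inj₂ λ a → h (inj₁ a))

  ⊨π⇔singleton : ∀ I → (S ⊨ I ∶ πf) ⇔ Singleton I
  ⊨π⇔singleton I = mk⇔ singleton ⊨π
    where
    singleton : S ⊨ I ∶ πf → Singleton I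
    singleton h with lo I ≟ hi I
    ... | yes lo≡hi = lo≡hi
    ... | no  lo≢hi =
      contradiction (start , (refl , ≤∧≢⇒< (lo≤hi I) lo≢hi) , ⊭false start) h
      where start = point (lo I) (≤-trans (lo≤hi I) (hi≤n I))
    ⊨π : Singleton I → S ⊨ I ∶ πf
    ⊨π lo≡hi (J , (lo≡ , hiJ<hi) , _) =
      <-irrefl lo≡hi (≤-<-trans (subst (_≤ hi J) (sym lo≡) (lo≤hi J)) hiJ<hi)

  ∈σ⇔labelling : ∀ I p → Singleton I → p ∈ₛ σ S I ⇔ T (labelling (lo I) p)
  ∈σ⇔labelling I p lo≡hi with lo I ≤? n
  ... | no  lo≰n = contradiction (≤-trans (lo≤hi I) (hi≤n I)) lo≰n
  ... | yes lo≤n rewrite Interval-≡ {I = point (lo I) lo≤n} {I} refl lo≡hi =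
    mk⇔ fromWitness toWitness

  ⊨π∧p⇔holds : ∀ p I → (S ⊨ I ∶ toForm (πp p)) ⇔ T (holds labelling (πp p) (lo I) (hi I))
  ⊨π∧p⇔holds p I = mk⇔ sound complete
    where
    π? : Dec (S ⊨ I ∶ πf)
    π? = map′ (from (⊨π⇔singleton I)) (to (⊨π⇔singleton I)) (lo I ≟ hi I)
    sound : S ⊨ I ∶ toForm (πp p) → T (holds labelling (πp p) (lo I) (hi I))
    sound h = from (T-∧ {⌊ lo I ≟ hi I ⌋})
                   (fromWitness lo≡hi , to (∈σ⇔labelling I p lo≡hi) p∈σ)
      where
      lo≡hi = to (⊨π⇔singleton I) (decidable-stable π? λ ⊭π → h (inj₁ ⊭π))
      p∈σ = decidable-stable (p ∈? σ S I) λ p∉σ → h (inj₂ p∉σ)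
    complete : T (holds labelling (πp p) (lo I) (hi I)) → S ⊨ I ∶ toForm (πp p)
    complete t with to (T-∧ {⌊ lo I ≟ hi I ⌋}) t
    ... | lo≟hi , labelled = λ
      { (inj₁ ⊭π)  → ⊭π (from (⊨π⇔singleton I) (toWitness lo≟hi))
      ; (inj₂ p∉σ) → p∉σ (from (∈σ⇔labelling I p (toWitness lo≟hi)) labelled) }

  ⊨⇔holds : ∀ φ I → (S ⊨ I ∶ toForm φ) ⇔ T (holds labelling φ (lo I) (hi I))
  ⊨⇔holds (πp p) I = ⊨π∧p⇔holds p I
  ⊨⇔holds (¬π φ) I = mk⇔ (λ ⊭ → from T-not (⊭ ∘ from (⊨⇔holds φ I)))
                          (λ t ⊨ → to T-not t (to (⊨⇔holds φ I) ⊨))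
  ⊨⇔holds (φ ∨π ψ) I = mk⇔
    (λ ⊨ → from T-∨ (Sum.map (to (⊨⇔holds φ I)) (to (⊨⇔holds ψ I)) ⊨))
    (λ t → Sum.map (from (⊨⇔holds φ I)) (from (⊨⇔holds ψ I)) (to T-∨ t))
  ⊨⇔holds (⟨B⟩π φ) I = mk⇔ sound complete
    where
    sound : S ⊨ I ∶ ⟨B⟩ (toForm φ) → T (holds labelling (⟨B⟩π φ) (lo I) (hi I))
    sound (J , (lo≡ , hiJ<hi) , ⊨J) =
      anyIn⁺ {b = hi I} (subst (_≤ hi J) (sym lo≡) (lo≤hi J)) hiJ<hi
             (subst (λ u → T (holds labelling φ u (hi J))) (sym lo≡) (to (⊨⇔holds φ J) ⊨J))
    complete : T (holds labelling (⟨B⟩π φ) (lo I) (hi I)) → S ⊨ I ∶ ⟨B⟩ (toForm φ)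
    complete t with anyIn⁻ {a = lo I} {b = hi I} t
    ... | c , lo≤c , c<hi , ⊨c = J , (refl , c<hi) , from (⊨⇔holds φ J) ⊨c
      where J = [ lo I , c ]⟨ lo≤c , ≤-trans (<⇒≤ c<hi) (hi≤n I) ⟩
  ⊨⇔holds (⟨E⟩π φ) I = mk⇔ sound complete
    where
    sound : S ⊨ I ∶ ⟨E⟩ (toForm φ) → T (holds labelling (⟨E⟩π φ) (lo I) (hi I))
    sound (J , (lo<loJ , hi≡) , ⊨J) =
      anyIn⁺ {b = suc (hi I)} lo<loJ (s≤s (subst (lo J ≤_) hi≡ (lo≤hi J)))
             (subst (λ u → T (holds labelling φ (lo J) u)) hi≡ (to (⊨⇔holds φ J) ⊨J))
    complete : T (holds labelling (⟨E⟩π φ) (lo I) (hi I)) → S ⊨ I ∶ ⟨E⟩ (toForm φ)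
    complete t with anyIn⁻ {a = suc (lo I)} {b = suc (hi I)} t
    ... | c , lo<c , c≤hi , ⊨c = J , (lo<c , refl) , from (⊨⇔holds φ J) ⊨c
      where J = [ c , hi I ]⟨ s≤s⁻¹ c≤hi , hi≤n I ⟩

lookup-injective : ∀ {A : Set} {xs : List A} → Unique xs →
                   ∀ i j → lookup xs i ≡ lookup xs j → i ≡ j
lookup-injective (_  ∷ _)    fzero    fzero    _  = refl
lookup-injective (x∉ ∷ _)    fzero    (fsuc j) eq = contradiction eq (All.lookup x∉ (∈-lookup j))
lookup-injective (x∉ ∷ _)    (fsuc i) fzero    eq =
  contradiction (sym eq) (All.lookup x∉ (∈-lookup i))
lookup-injective (_  ∷ uniq) (fsuc i) (fsuc j) eq = cong fsuc (lookup-injective uniq i j eq)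

length≤-by-code : ∀ {A : Set} {B} {xs : List A} → Unique xs → (code : A → Fin B) →
                  (∀ {a b} → a ∈ xs → b ∈ xs → code a ≡ code b → a ≡ b) → length xs ≤ B
length≤-by-code {B = B} {xs} uniq code code-injective with length xs ≤? B
... | yes ≤B = ≤B
... | no  ≰B with Fin.pigeonhole (≰⇒> ≰B) (code ∘ lookup xs)
...   | i , j , i<j , same-code
  with refl ← lookup-injective uniq i j (code-injective (∈-lookup i) (∈-lookup j) same-code)
  = contradiction i<j (<-irrefl refl)

module _ {n k} (S : Structure n k) (φ : BEπ k) {z : ℕ} where

  private
    L = labelling S

  prefixMinimal-hi≤ : ∀ {I J} → z ∈ᵢ I → z ∈ᵢ J →
                      S ⊨ I ∶ toForm φ → PrefixMinimal S φ J →
                      profile L z φ (lo I) ≡ profile L z φ (lo J) → hi J ≤ hi I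
  prefixMinimal-hi≤ {I} {J} z∈I z∈J ⊨I (_ , minimalJ) same with hi J ≤? hi I
  ... | yes hiJ≤hiI = hiJ≤hiI
  ... | no  hiJ≰hiI = contradiction ⊨K (minimalJ K (refl , ≰⇒> hiJ≰hiI))
    where
    K = [ lo J , hi I ]⟨ ≤-trans (proj₁ z∈J) (proj₂ z∈I) , hi≤n I ⟩
    ⊨K = from (⊨⇔holds S φ K)
           (subst T (profile-separates L z φ (proj₁ z∈I) (proj₁ z∈J) (proj₂ z∈I) same)
                    (to (⊨⇔holds S φ I) ⊨I))

  suffixMinimal-lo≤ : ∀ {I J} → z ∈ᵢ I → z ∈ᵢ J →
                      SuffixMinimal S φ I → S ⊨ J ∶ toForm φ →
                      rightProfile L z n φ (hi J) ≡ rightProfile L z n φ (hi I) → lo J ≤ lo I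
  suffixMinimal-lo≤ {I} {J} z∈I z∈J (_ , minimalI) ⊨J same with lo J ≤? lo I
  ... | yes loJ≤loI = loJ≤loI
  ... | no  loJ≰loI = contradiction ⊨K (minimalI K (≰⇒> loJ≰loI , refl))
    where
    K = [ lo J , hi I ]⟨ ≤-trans (proj₁ z∈J) (proj₂ z∈I) , hi≤n I ⟩
    ⊨K = from (⊨⇔holds S φ K)
           (subst T (rightProfile-separates L φ (proj₁ z∈J) (proj₂ z∈J) (proj₂ z∈I)
                                            (hi≤n J) (hi≤n I) same)
                    (to (⊨⇔holds S φ J) ⊨J))

  prefixMinimal-family-bound : ∀ {𝓘} → Unique 𝓘 → (∀ I → I ∈ 𝓘 → z ∈ᵢ I) →
                               (∀ I → I ∈ 𝓘 → PrefixMinimal S φ I) → DistinctRight 𝓘 →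
                               length 𝓘 ≤ 2 ^ size φ
  prefixMinimal-family-bound {𝓘} uniq through minimal distinct =
    length≤-by-code uniq (profile L z φ ∘ lo) same-profile⇒≡
    where
    same-profile⇒≡ : ∀ {I J} → I ∈ 𝓘 → J ∈ 𝓘 →
                     profile L z φ (lo I) ≡ profile L z φ (lo J) → I ≡ J
    same-profile⇒≡ I∈ J∈ same = distinct _ _ I∈ J∈ (≤-antisym (hi≤ J∈ I∈ (sym same)) (hi≤ I∈ J∈ same))
      where
      hi≤ : ∀ {I J} → I ∈ 𝓘 → J ∈ 𝓘 → profile L z φ (lo I) ≡ profile L z φ (lo J) → hi J ≤ hi I
      hi≤ {I} {J} I∈ J∈ =
        prefixMinimal-hi≤ (through I I∈) (through J J∈) (proj₁ (minimal I I∈)) (minimal J J∈)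

  suffixMinimal-family-bound : ∀ {𝓘} → Unique 𝓘 → (∀ I → I ∈ 𝓘 → z ∈ᵢ I) →
                               (∀ I → I ∈ 𝓘 → SuffixMinimal S φ I) → DistinctLeft 𝓘 →
                               length 𝓘 ≤ 2 ^ size φ
  suffixMinimal-family-bound {𝓘} uniq through minimal distinct =
    subst (λ s → length 𝓘 ≤ 2 ^ s) (size-mirror φ)
          (length≤-by-code uniq (rightProfile L z n φ ∘ hi) same-profile⇒≡)
    where
    same-profile⇒≡ : ∀ {I J} → I ∈ 𝓘 → J ∈ 𝓘 →
                     rightProfile L z n φ (hi I) ≡ rightProfile L z n φ (hi J) → I ≡ J
    same-profile⇒≡ I∈ J∈ same = distinct _ _ I∈ J∈ (≤-antisym (lo≤ J∈ I∈ same) (lo≤ I∈ J∈ (sym same)))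
      where
      lo≤ : ∀ {I J} → I ∈ 𝓘 → J ∈ 𝓘 →
            rightProfile L z n φ (hi J) ≡ rightProfile L z n φ (hi I) → lo J ≤ lo I
      lo≤ {I} {J} I∈ J∈ =
        suffixMinimal-lo≤ (through I I∈) (through J J∈) (minimal I I∈) (proj₁ (minimal J J∈))

module _ {n} {𝓘′ 𝓘 : List (Interval n)} (𝓘′⊆𝓘 : SubFamily 𝓘′ 𝓘) where

  restrict : {P : Interval n → Set} → (∀ I → I ∈ 𝓘 → P I) → ∀ I → I ∈ 𝓘′ → P I
  restrict all I I∈ = all I (𝓘′⊆𝓘 I I∈)

  restrict₂ : {R : Interval n → Interval n → Set} →
              (∀ I J → I ∈ 𝓘 → J ∈ 𝓘 → R I J) →
              ∀ I J → I ∈ 𝓘′ → J ∈ 𝓘′ → R I J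
  restrict₂ all I J I∈ J∈ = all I J (𝓘′⊆𝓘 I I∈) (𝓘′⊆𝓘 J J∈)

2^m≤2^[2*m] : ∀ m → 2 ^ m ≤ 2 ^ (2 * m)
2^m≤2^[2*m] m = ^-monoʳ-≤ 2 (m≤m+n m (m + 0))

lemma3 : {n k : ℕ} (S : Structure n k) (φ : BEπ k)
         (𝓘 𝓘' : List (Interval n)) →
         Unique 𝓘 →
         Intersecting 𝓘 →
         (∀ I → I ∈ 𝓘 → ¬ Singleton I) →
         (((∀ I → I ∈ 𝓘 → PrefixMinimal S φ I) × DistinctRight 𝓘)
           ⊎ ((∀ I → I ∈ 𝓘 → SuffixMinimal S φ I) × DistinctLeft 𝓘)) →
         Unique 𝓘' →
         SubFamily 𝓘' 𝓘 →
         (Chain 𝓘' ⊎ AntiChain 𝓘') →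
         length 𝓘' ≤ 2 ^ (2 * size φ)
lemma3 S φ _ _ _ (_ , through) _ (inj₁ (minimal , distinct)) unique′ 𝓘′⊆𝓘 _ =
  ≤-trans (prefixMinimal-family-bound S φ unique′ (restrict 𝓘′⊆𝓘 through)
             (restrict 𝓘′⊆𝓘 minimal) (restrict₂ 𝓘′⊆𝓘 distinct))
          (2^m≤2^[2*m] (size φ))
lemma3 S φ _ _ _ (_ , through) _ (inj₂ (minimal , distinct)) unique′ 𝓘′⊆𝓘 _ =
  ≤-trans (suffixMinimal-family-bound S φ unique′ (restrict 𝓘′⊆𝓘 through)
             (restrict 𝓘′⊆𝓘 minimal) (restrict₂ 𝓘′⊆𝓘 distinct))
          (2^m≤2^[2*m] (size φ))
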